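{- Let $\mathcal{A}$ be a weighted pushdown system with state set $Q$ and stack alphabet $\Gamma$, and let $\pi$ be a finite path in $\mathcal{A}$ with additional stack height $\mathrm{ASH}(\pi)=d\geq(|Q|\cdot|\Gamma|)^2$. Then $\pi$ has a pumpable pair of paths.
   Context: A weighted pushdown system (WPS) is $\mathcal{A}=\langle Q,\Gamma,q_0,E,w\rangle$: finite states $Q$, initial state $q_0$, finite stack alphabet $\Gamma$ with bottom symbol $\bot$ (never pushed or popped), finite edge set $E\subseteq(Q\times\Gamma)\times(Q\times\mathrm{Com}(\Gamma))$ with $\mathrm{Com}(\Gamma)=\{\mathit{skip},\mathit{pop}\}\cup\{\mathit{push}(z)\mid z\in\Gamma\}$, and $w:E\to\mathbb{Z}$. Configurations are $(\alpha,q)$, $\alpha\in\Gamma^+$; $(\alpha',q')$ is a successor of $(\alpha,q)$ if some edge $(q,\gamma,q',\mathit{com})$ has $\gamma$ the top of $\alpha$ and $\alpha'=\mathit{com}(\alpha)$. A path is a sequence of configurations (starting anywhere) each a successor of the previous; equivalently $\langle c_1e_1e_2\dots\rangle$ with starting configuration $c_1$ and edges $e_i$. For a finite path $\pi=\langle(\alpha_1,q_1),\dots,(\alpha_n,q_n)\rangle$, its stack height is $\mathrm{SH}(\pi)=\max_i|\alpha_i|$ and its additional stack height is $\mathrm{ASH}(\pi)=\mathrm{SH}(\pi)-\max\{|\alpha_1|,|\alpha_n|\}$. A pumpable pair for a path $\pi=\langle c_1e_1e_2\dots\rangle$ is a pair of nonempty contiguous edge segments $p_1=e_{i_1}\dots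 e_{i_1+n_1}$ and $p_2=e_{i_2}\dots e_{i_2+n_2}$ of $\pi$ with $i_2>i_1+n_1$ such that for every $j\geq 0$ the sequence obtained from $\pi$ by replacing $p_1$ by $p_1^j$ and $p_2$ by $p_2^j$ (starting from $c_1$) is a valid path. -}

module Defs where

open import Data.Nat using (ℕ; zero; suc; _+_; _*_; _∸_; _⊔_; _≥_; _^_)
open import Data.Integer using (ℤ)
open import Data.Fin using (Fin; _≟_)
open import Data.List using (List; []; _∷_; _++_; concat; replicate)
open import Data.List.NonEmpty using (List⁺; _∷_; _∷⁺_; head; last; toList)
import Data.List.NonEmpty as L⁺
open import Data.Maybe using (Maybe; just; nothing; _>>=_; Is-just)
import Data.Maybe as M
open import Data.Product using (_×_; _,_; proj₁; proj₂; ∃-syntax)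
open import Relation.Nullary using (yes; no; ¬_)
open import Relation.Binary.PropositionalEquality using (_≡_; _≢_)

data Com (nΓ : ℕ) : Set where
  skip : Com nΓ
  pop  : Com nΓ
  push : Fin nΓ → Com nΓ

record Edge (nQ nΓ : ℕ) : Set where
  constructor mkEdge
  field
    src : Fin nQ
    top : Fin nΓ
    tgt : Fin nQ
    com : Com nΓ

-- A weighted pushdown system: Q = Fin nQ, Γ = Fin nΓ, the finite edge set
-- E is indexed by Fin nE (edge i), with weight w : E → ℤ.
record WPS : Set where
  field
    nQ nΓ nE : ℕ
    q₀     : Fin nQ
    bot    : Fin nΓ
    edge   : Fin nE → Edge nQ nΓ
    w      : Fin nE → ℤ
    no-push-bot : ∀ i → Edge.com (edge i) ≢ push bot
    no-pop-bot  : ∀ i → Edge.top (edge i) ≡ bot → Edge.com (edge i) ≢ pop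

module _ (A : WPS) where
  open WPS A

  -- configuration (α , q): stack α ∈ Γ⁺ with the top as the head
  Config : Set
  Config = List⁺ (Fin nΓ) × Fin nQ

  -- com(α), undefined (nothing) when the result would be the empty stack
  applyCom : Com nΓ → List⁺ (Fin nΓ) → Maybe (List⁺ (Fin nΓ))
  applyCom skip     α              = just α
  applyCom (push z) α              = just (z ∷⁺ α)
  applyCom pop      (γ ∷ [])       = nothing
  applyCom pop      (γ ∷ (x ∷ xs)) = just (x ∷ xs)

  step : Config → Fin nE → Maybe Config
  step (α , q) i with q ≟ Edge.src (edge i) | head α ≟ Edge.top (edge i)
  ... | yes _ | yes _ = M.map (λ α' → (α' , Edge.tgt (edge i))) (applyCom (Edge.com (edge i)) α)
  ... | _     | _     = nothing

  configs : Config → List (Fin nE) → Maybe (List⁺ Config)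
  configs c []       = just (c ∷ [])
  configs c (i ∷ es) = step c i >>= λ c' → M.map (c ∷⁺_) (configs c' es)

  ValidPath : Config → List (Fin nE) → Set
  ValidPath c es = Is-just (configs c es)

  stackLen : Config → ℕ
  stackLen c = L⁺.length (proj₁ c)

  SH : List⁺ Config → ℕ
  SH cs = Data.List.foldr (λ c m → stackLen c ⊔ m) 0 (toList cs)
    where import Data.List

  ASH : List⁺ Config → ℕ
  ASH cs = SH cs ∸ (stackLen (head cs) ⊔ stackLen (last cs))

  rep : ℕ → List (Fin nE) → List (Fin nE)
  rep j p = concat (replicate j p)

  PumpablePair : Config → List (Fin nE) → Set
  PumpablePair c es =
    ∃[ u ] ∃[ p₁ ] ∃[ v ] ∃[ p₂ ] ∃[ x ]
      (es ≡ u ++ p₁ ++ v ++ p₂ ++ x) × (p₁ ≢ []) × (p₂ ≢ []) ×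
      (∀ (j : ℕ) → ValidPath c (u ++ rep j p₁ ++ v ++ rep j p₂ ++ x))

module Submission where

-- Let M be the larger of the two end heights of the path and d ≥ K the
-- additional stack height, K = (|Q|·|Γ|)². Cutting the path at its
-- highest configuration, the last crossing of height M before the peak
-- (a push of a symbol z ≠ ⊥ onto a stack L of height M, in state q) and
-- the first crossing after it (back to z on top of L, in state r) bound a
-- "hump" with key (z , q , r): a run from the one-symbol stack z to
-- itself, reaching height K above L, which never touches L and can therefore be
-- replayed on any stack.  Repeating the argument inside the hump with
-- M = 1 yields a tower of K strictly nested humps.  There are only
-- |Q|·(|Γ|−1)·|Q| < K keys, so two humps of the tower share a key; the
-- part of the outer one climbing to the inner one and the part coming
-- back down are the pumpable pair.

open import Defs
open import Data.Nat
  using (ℕ; zero; suc; _+_; _*_; _∸_; _⊔_; _≤_; _<_; _≥_; _^_; _≤?_; pred; z≤n; s≤s; s≤s⁻¹; NonZero; >-nonZero)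
open import Data.Nat.Properties
  using ( ≤-refl; ≤-trans; ≤-reflexive; ≤-antisym; ≤-total; <-≤-trans; ≤-<-trans; <⇒≤; <⇒≱; ≰⇒>; <-irrefl
        ; n<1+n; m<m+n; m≤n+m; +-comm; +-cancelˡ-≤; *-assoc; *-identityʳ; *-monoʳ-<; *-monoˡ-<; *-monoʳ-≤; m≤m*n
        ; ⊔-identityʳ; ⊔-lub; m≤m⊔n; m≤n⊔m; m≤o∸n⇒m+n≤o; m∸n≢0⇒n<m; m<n⇒n≢0; suc-pred; suc-injective
        ; 0≢1+n; module ≤-Reasoning)
open import Data.List using (List; []; _∷_; _++_; _∷ʳ_; length; initLast; _∷ʳ′_)
open import Data.List.Properties using (++-assoc; ++-identityʳ; ++-monoid; length-++; ++-conicalˡ; ++-conicalʳ)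
open import Data.List.Reverse using (Reverse; []; _∶_∶ʳ_; reverseView)
open import Data.List.NonEmpty using (List⁺; _∷_; _∷⁺_; _⁺++_; head; tail; last; toList)
import Data.List.NonEmpty as List⁺
open import Data.Fin using (Fin; zero; suc; _≟_; punchOut; combine) renaming (_<_ to _<ᶠ_)
open import Data.Fin.Properties using (punchOut-injective; combine-injective; pigeonhole; nonZeroIndex)
open import Data.Maybe using (just; nothing)
open import Data.Maybe.Relation.Unary.Any using (just)
open import Data.Product using (_×_; _,_; proj₁; proj₂; ∃-syntax)
open import Data.Sum using (_⊎_; inj₁; inj₂)
open import Data.Unit using (tt)
open import Data.Empty using (⊥-elim)
open import Relation.Nullary using (yes; no)
open import Relation.Binary.PropositionalEquality
open import Function using (_∘_)
open import Tactic.MonoidSolver using (solve)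

last-∷⁺ : ∀ {X : Set} (x : X) (ys : List⁺ X) → last (x ∷⁺ ys) ≡ last ys
last-∷⁺ x (y ∷ ys) with initLast ys
... | []       = refl
... | zs ∷ʳ′ z = refl

length-⁺++ : ∀ {X : Set} (T : List⁺ X) (L : List X) →
  List⁺.length (T ⁺++ L) ≡ List⁺.length T + length L
length-⁺++ (x ∷ xs) L = cong suc (length-++ xs)

gap-below : ∀ M S h → suc h ≤ S ∸ M → M + suc h ≤ S
gap-below M S h gap =
  subst (_≤ S) (+-comm (suc h) M) (m≤o∸n⇒m+n≤o (suc h) M≤S gap)
  where
    M≤S : M ≤ S
    M≤S = <⇒≤ (m∸n≢0⇒n<m (m<n⇒n≢0 gap))

-- There are fewer keys (a state, a symbol other than ⊥, a state) than
-- (|Q|·|Γ|)², provided both sets are non-empty.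
keys<bound : ∀ q g .{{_ : NonZero q}} .{{_ : NonZero g}} → q * (pred g * q) < (q * g) ^ 2
keys<bound q@(suc _) g@(suc b) = begin-strict
  q * (b * q)       <⟨ *-monoʳ-< q (*-monoˡ-< q (n<1+n b)) ⟩
  q * (g * q)       ≡⟨ sym (*-assoc q g q) ⟩
  q * g * q         ≤⟨ *-monoʳ-≤ (q * g) (m≤m*n q g) ⟩
  q * g * (q * g)   ≡⟨ cong (q * g *_) (sym (*-identityʳ (q * g))) ⟩
  (q * g) ^ 2       ∎
  where open ≤-Reasoning

encode-key : ∀ {q g} (b : Fin (suc g)) (k : Fin (suc g) × Fin q × Fin q) → proj₁ k ≢ b → Fin (q * (g * q))
encode-key b (z , q , r) z≢b = combine q (combine (punchOut (≢-sym z≢b)) r)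

encode-key-injective : ∀ {q g} (b : Fin (suc g)) (k k' : Fin (suc g) × Fin q × Fin q)
  (k≢b : proj₁ k ≢ b) (k'≢b : proj₁ k' ≢ b) → encode-key b k k≢b ≡ encode-key b k' k'≢b → k ≡ k'
encode-key-injective b (z , q , r) (z' , q' , r') z≢b z'≢b same
  with refl , same′ ← combine-injective q _ q' _ same
  with same-z , refl ← combine-injective _ r _ r' same′
  with refl ← punchOut-injective (≢-sym z≢b) (≢-sym z'≢b) same-z
  = refl

key-collision : ∀ {m q g} (b : Fin g) (f : Fin m → Fin g × Fin q × Fin q) →
  (∀ i → proj₁ (f i) ≢ b) → q * (pred g * q) < m → ∃[ i ] ∃[ j ] i <ᶠ j × f i ≡ f j
key-collision {g = suc _} b f avoids bound
  with i , j , i<j , same ← pigeonhole bound (λ i → encode-key b (f i) (avoids i))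
  = i , j , i<j , encode-key-injective b (f i) (f j) (avoids i) (avoids j) same

module Pumping (A : WPS) where
  open WPS A

  Γ Q E : Set
  Γ = Fin nΓ
  Q = Fin nQ
  E = Fin nE

  Stack : Set
  Stack = List⁺ Γ

  height : Config A → ℕ
  height = stackLen A

  -- Commands only look at the top of the stack, so they commute with
  -- extending the stack at the bottom.
  applyCom-frame : ∀ cm (T T' : Stack) L →
    applyCom A cm T ≡ just T' → applyCom A cm (T ⁺++ L) ≡ just (T' ⁺++ L)
  applyCom-frame skip     T            T' L refl = refl
  applyCom-frame pop      (γ ∷ x ∷ xs) T' L refl = refl
  applyCom-frame (push z) (x ∷ xs)     T' L refl = refl

  applyCom-unframe : ∀ cm (T : Stack) L {β} → applyCom A cm (T ⁺++ L) ≡ just β →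
    (∃[ T' ] applyCom A cm T ≡ just T' × β ≡ T' ⁺++ L) ⊎ (tail T ≡ [] × toList β ≡ L)
  applyCom-unframe skip     T            L       refl = inj₁ (T , refl , refl)
  applyCom-unframe pop      (γ ∷ [])     []      ()
  applyCom-unframe pop      (γ ∷ [])     (x ∷ L) refl = inj₂ (refl , refl)
  applyCom-unframe pop      (γ ∷ t ∷ ts) L       refl = inj₁ (t ∷ ts , refl , refl)
  applyCom-unframe (push z) (x ∷ xs)     L       refl = inj₁ (z ∷ x ∷ xs , refl , refl)

  applyCom-grows : ∀ cm (α β : Stack) → applyCom A cm α ≡ just β →
    List⁺.length α < List⁺.length β → ∃[ z ] cm ≡ push z × β ≡ z ∷⁺ α
  applyCom-grows skip     α            β refl α<α = ⊥-elim (<-irrefl refl α<α)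
  applyCom-grows pop      (γ ∷ x ∷ xs) β refl α<β = ⊥-elim (<⇒≱ α<β (<⇒≤ (n<1+n _)))
  applyCom-grows (push z) α            β refl _   = z , refl , refl

  applyCom-bottom : ∀ cm (α β : Stack) → applyCom A cm α ≡ just β → last α ≡ last β
  applyCom-bottom skip     α            β refl = refl
  applyCom-bottom pop      (γ ∷ x ∷ xs) β refl = last-∷⁺ γ (x ∷ xs)
  applyCom-bottom (push z) α            β refl = sym (last-∷⁺ z α)

  -- Edge i fires in configuration c and leads to c': the relational
  -- reading of `step`, convenient for inversion.
  record Move (i : E) (c c' : Config A) : Set where
    constructor move
    field
      at-src    : proj₂ c ≡ Edge.src (edge i)
      reads-top : head (proj₁ c) ≡ Edge.top (edge i)
      applies   : applyCom A (Edge.com (edge i)) (proj₁ c) ≡ just (proj₁ c')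
      to-tgt    : proj₂ c' ≡ Edge.tgt (edge i)

  step-sound : ∀ {c c' i} → step A c i ≡ just c' → Move i c c'
  step-sound {α , q} {_} {i} eq with q ≟ Edge.src (edge i) | head α ≟ Edge.top (edge i)
  step-sound {α , q} {_} {i} eq | yes q≡ | yes h≡ with applyCom A (Edge.com (edge i)) α in ap
  step-sound {α , q} {_} {i} refl | yes q≡ | yes h≡ | just α' = move q≡ h≡ ap refl
  step-sound {α , q} {_} {i} ()   | yes q≡ | yes h≡ | nothing
  step-sound {α , q} {_} {i} ()   | yes _  | no _
  step-sound {α , q} {_} {i} ()   | no _   | _

  step-complete : ∀ {c c' i} → Move i c c' → step A c i ≡ just c'
  step-complete {α , q} {_} {i} (move q≡ h≡ ap refl) with q ≟ Edge.src (edge i) | head α ≟ Edge.top (edge i)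
  ... | yes _  | yes _  rewrite ap = refl
  ... | no q≢  | _      = ⊥-elim (q≢ q≡)
  ... | yes _  | no h≢  = ⊥-elim (h≢ h≡)

  move-frame : ∀ {i T q T' q'} L → Move i (T , q) (T' , q') → Move i (T ⁺++ L , q) (T' ⁺++ L , q')
  move-frame {T = x ∷ xs} L (move s h ap t) = move s h (applyCom-frame _ (x ∷ xs) _ L ap) t

  move-unframe : ∀ {i T L q β q'} → Move i (T ⁺++ L , q) (β , q') →
    (∃[ T' ] Move i (T , q) (T' , q') × β ≡ T' ⁺++ L) ⊎ (tail T ≡ [] × toList β ≡ L)
  move-unframe {T = x ∷ xs} (move s h ap t) with applyCom-unframe _ (x ∷ xs) _ ap
  ... | inj₁ (T' , ap' , β≡) = inj₁ (T' , move s h ap' t , β≡)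
  ... | inj₂ popped          = inj₂ popped

  move-push : ∀ {i c c'} → Move i c c' → height c < height c' →
    ∃[ z ] z ≢ bot × proj₁ c' ≡ z ∷⁺ proj₁ c
  move-push {i} mv raises with applyCom-grows _ _ _ (Move.applies mv) raises
  ... | z , com≡ , β≡ = z , (λ z≡ → no-push-bot i (trans com≡ (cong push z≡))) , β≡

  infixr 5 _▹_
  data Run : Config A → List E → Config A → Set where
    done : ∀ {c} → Run c [] c
    _▹_  : ∀ {c i c₁ es c'} → Move i c c₁ → Run c₁ es c' → Run c (i ∷ es) c'

  run-++ : ∀ {c es c₁ fs c'} → Run c es c₁ → Run c₁ fs c' → Run c (es ++ fs) c'
  run-++ done       r = r
  run-++ (mv ▹ r₁) r₂ = mv ▹ run-++ r₁ r₂

  run-split : ∀ {c fs c'} es → Run c (es ++ fs) c' → ∃[ c₁ ] Run c es c₁ × Run c₁ fs c'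
  run-split []       r        = _ , done , r
  run-split (i ∷ es) (mv ▹ r) with c₁ , r₁ , r₂ ← run-split es r = c₁ , mv ▹ r₁ , r₂

  run-unsnoc : ∀ {c i c'} es → Run c (es ∷ʳ i) c' → ∃[ c₀ ] Run c es c₀ × Move i c₀ c'
  run-unsnoc es r with c₀ , r₀ , mv ▹ done ← run-split es r = c₀ , r₀ , mv

  run-frame : ∀ {T q es T' q'} L → Run (T , q) es (T' , q') → Run (T ⁺++ L , q) es (T' ⁺++ L , q')
  run-frame L done                      = done
  run-frame L (_▹_ {c₁ = _ , _} mv r) = move-frame L mv ▹ run-frame L r

  run-bottom : ∀ {c es c'} → Run c es c' → last (proj₁ c) ≡ last (proj₁ c')
  run-bottom done     = refl
  run-bottom (mv ▹ r) = trans (applyCom-bottom _ _ _ (Move.applies mv)) (run-bottom r)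

  run-moves : ∀ {c es c'} → Run c es c' → height c ≢ height c' → es ≢ []
  run-moves done    differ refl = differ refl
  run-moves (_ ▹ _) differ ()

  run-valid : ∀ {c es c'} → Run c es c' → ValidPath A c es
  run-valid done = just tt
  run-valid {c} (_▹_ {c₁ = c₁} {es = es} mv r) rewrite step-complete mv
    with configs A c₁ es | run-valid r
  ... | just _ | just _ = just tt

  configs-∷ : ∀ c i es {cs} → configs A c (i ∷ es) ≡ just cs →
    ∃[ c₁ ] ∃[ cs₁ ] step A c i ≡ just c₁ × configs A c₁ es ≡ just cs₁ × cs ≡ c ∷⁺ cs₁
  configs-∷ c i es eq with step A c i
  configs-∷ c i es eq | just c₁ with configs A c₁ es in eq₁
  configs-∷ c i es refl | just c₁ | just cs₁ = c₁ , cs₁ , refl , eq₁ , refl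
  configs-∷ c i es ()   | just c₁ | nothing
  configs-∷ c i es ()   | nothing

  configs-head : ∀ c es {cs} → configs A c es ≡ just cs → head cs ≡ c
  configs-head c []       refl = refl
  configs-head c (i ∷ es) eq with _ , _ ∷ _ , _ , _ , refl ← configs-∷ c i es eq = refl

  record HighRun (H : ℕ) (c : Config A) (es : List E) (c' : Config A) : Set where
    constructor high-run
    field
      peak       : Config A
      pre post   : List E
      splits     : es ≡ pre ++ post
      to-peak    : Run c pre peak
      from-peak  : Run peak post c'
      high       : H ≤ height peak

  highrun-run : ∀ {H c es c'} → HighRun H c es c' → Run c es c'
  highrun-run (high-run _ _ _ refl r₁ r₂ _) = run-++ r₁ r₂

  highrun-lower : ∀ {H H' c es c'} → H' ≤ H → HighRun H c es c' → HighRun H' c es c'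
  highrun-lower H'≤H (high-run d pre post eq r₁ r₂ hi) = high-run d pre post eq r₁ r₂ (≤-trans H'≤H hi)

  configs-peak : ∀ c es {cs} → configs A c es ≡ just cs → HighRun (SH A cs) c es (last cs)
  configs-peak c [] refl = high-run c [] [] refl done done (≤-reflexive (⊔-identityʳ (height c)))
  configs-peak c (i ∷ es) eq
    with c₁ , cs₁@(_ ∷ _) , st , eq₁ , refl ← configs-∷ c i es eq
    with high-run d pre post refl r₁ r₂ hi ← configs-peak c₁ es eq₁
    = subst (HighRun _ c (i ∷ pre ++ post)) (sym (last-∷⁺ c cs₁)) highest
    where
      highest : HighRun (height c ⊔ SH A cs₁) c (i ∷ pre ++ post) (last cs₁)
      highest with ≤-total (SH A cs₁) (height c)
      ... | inj₁ below = high-run c [] _ refl done (step-sound st ▹ run-++ r₁ r₂) (⊔-lub ≤-refl below)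
      ... | inj₂ above = high-run d (i ∷ pre) post refl (step-sound st ▹ r₁) r₂ (⊔-lub (≤-trans above hi) hi)

  record Ascent (M : ℕ) (c : Config A) (es : List E) (d : Config A) : Set where
    constructor ascent
    field
      u s    : List E
      z      : Γ
      L      : List Γ
      q p    : Q
      T      : Stack
      splits : es ≡ u ++ s
      floor  : length L ≡ M
      pushed : z ≢ bot
      climb  : Run c u (z ∷ L , q)
      above  : Run (z ∷ [] , q) s (T , p)
      at-end : d ≡ (T ⁺++ L , p)

  last-crossing : ∀ {M c es d} → Reverse es → Run c es d → height c ≤ M → M < height d → Ascent M c es d
  last-crossing [] done low high = ⊥-elim (<⇒≱ high low)
  last-crossing {M} {d = β@(_ ∷ _) , p} (es ∶ rs ∶ʳ i) r low high
    with (α₀@(_ ∷ _) , _) , r₀ , mv ← run-unsnoc es r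
    with List⁺.length α₀ ≤? M
  ... | yes α₀≤M with z , z≢⊥ , refl ← move-push mv (≤-<-trans α₀≤M high) =
    ascent (es ∷ʳ i) [] z (toList α₀) p p (z ∷ []) (sym (++-identityʳ _))
      (≤-antisym α₀≤M (s≤s⁻¹ high)) z≢⊥ (run-++ r₀ (mv ▹ done)) done refl
  ... | no α₀≰M
    with ascent u s z L q _ T refl floor z≢⊥ climb above refl ← last-crossing rs r₀ low (≰⇒> α₀≰M)
    with move-unframe {T = T} {L = L} mv
  ...   | inj₁ (T' , mv' , refl) =
    ascent u (s ∷ʳ i) z L q p T' (++-assoc u s (i ∷ [])) floor z≢⊥ climb (run-++ above (mv' ▹ done)) refl
  ...   | inj₂ (_ , toList-β≡L) =
    ⊥-elim (<-irrefl (sym (trans (cong length toList-β≡L) floor)) high)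

  record Descent (L : List Γ) (T : Stack) (p : Q) (es : List E) (c' : Config A) : Set where
    constructor descent
    field
      s x    : List E
      z      : Γ
      r      : Q
      splits : es ≡ s ++ x
      above  : Run (T , p) s (z ∷ [] , r)
      leave  : Run (z ∷ L , r) x c'

  first-crossing : ∀ {L T p es c'} → Run (T ⁺++ L , p) es c' → height c' ≤ length L → Descent L T p es c'
  first-crossing {L} {T} done low =
    ⊥-elim (<⇒≱ (stack-above T) (subst (_≤ length L) (length-⁺++ T L) low))
    where
      stack-above : ∀ (T : Stack) → length L < List⁺.length T + length L
      stack-above (_ ∷ ts) = s≤s (m≤n+m (length L) (length ts))
  first-crossing {L} {t ∷ ts} {p} (_▹_ {c₁ = _ , _} mv r) low with move-unframe {T = t ∷ ts} {L = L} mv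
  ... | inj₁ (T₁ , mv' , refl) with descent s x z r' refl above leave ← first-crossing r low =
    descent (_ ∷ s) x z r' refl (mv' ▹ above) leave
  ... | inj₂ (refl , _) = descent [] _ t p refl done (mv ▹ r)

  record Excursion (M h : ℕ) (c : Config A) (es : List E) (c' : Config A) : Set where
    constructor excursion
    field
      u s x  : List E
      z      : Γ
      L      : List Γ
      q r    : Q
      splits : es ≡ u ++ s ++ x
      floor  : length L ≡ M
      pushed : z ≢ bot
      climb  : Run c u (z ∷ L , q)
      hump   : HighRun (suc h) (z ∷ [] , q) s (z ∷ [] , r)
      leave  : Run (z ∷ L , r) x c'

  -- Cut at the peak, take the last crossing of height M before it and the
  -- first one after it; both crossings push/pop the same z since runs
  -- preserve the bottom symbol of the hump.
  excursion-of : ∀ {M h c es c'} → HighRun (M + suc h) c es c' → height c ≤ M → height c' ≤ M →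
    Excursion M h c es c'
  excursion-of {M} {h} (high-run (β , p) pre post refl r₁ r₂ hi) low low'
    with ascent u s₁ z L q p T refl refl z≢⊥ climb above₁ refl
           ← last-crossing (reverseView pre) r₁ low (<-≤-trans (m<m+n M (s≤s z≤n)) hi)
    with descent s₂ x z' r refl above₂ leave ← first-crossing {T = T} r₂ low'
    with refl ← run-bottom (run-++ above₁ above₂)
    = excursion u (s₁ ++ s₂) x z L q r (regroup-3 u s₁ s₂ x) refl z≢⊥ climb
        (high-run (T , p) s₁ s₂ refl above₁ above₂ T-high) leave
    where
      regroup-3 : ∀ (u a b x : List E) → (u ++ a) ++ (b ++ x) ≡ u ++ (a ++ b) ++ x
      regroup-3 u a b x = solve (++-monoid E)
      T-high : suc h ≤ List⁺.length T
      T-high = +-cancelˡ-≤ (length L) _ _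
        (subst (length L + suc h ≤_) (trans (length-⁺++ T L) (+-comm _ (length L))) hi)

  -- Keys of humps: the pushed symbol and the states at both ends.
  Key : Set
  Key = Γ × Q × Q

  #keys : ℕ
  #keys = nQ * (pred nΓ * nQ)

  entry-over exit-over : Key → List Γ → Config A
  entry-over (z , q , _) P = z ∷ P , q
  exit-over  (z , _ , r) P = z ∷ P , r

  entry exit : Key → Config A
  entry k = entry-over k []
  exit  k = exit-over k []

  record Encloses (k k' : Key) (s s' : List E) : Set where
    constructor encloses
    field
      y w    : List E
      P      : List Γ
      splits : s ≡ y ++ s' ++ w
      y≢[]   : y ≢ []
      w≢[]   : w ≢ []
      climb  : Run (entry k) y (entry-over k' P)
      leave  : Run (exit-over k' P) w (exit k)

  encloses-run : ∀ {k k' s s'} → Encloses k k' s s' → Run (entry k') s' (exit k') → Run (entry k) s (exit k)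
  encloses-run {k' = _ , _ , _} (encloses _ _ P refl _ _ climb leave) r =
    run-++ climb (run-++ (run-frame P r) leave)

  encloses-trans : ∀ {k₁ k₂ k₃ s₁ s₂ s₃} → Encloses k₁ k₂ s₁ s₂ → Encloses k₂ k₃ s₂ s₃ → Encloses k₁ k₃ s₁ s₃
  encloses-trans {k₂ = _ , _ , _} {k₃ = _ , _ , _}
    (encloses y w P refl y≢[] w≢[] climb leave) (encloses y' w' P' refl _ _ climb' leave') =
    encloses (y ++ y') (w' ++ w) (P' ++ P) (regroup-5 y y' _ w' w)
      (y≢[] ∘ ++-conicalˡ y y') (w≢[] ∘ ++-conicalʳ w' w)
      (run-++ climb (run-frame P climb')) (run-++ (run-frame P leave') leave)
    where
      regroup-5 : ∀ (y y' s w' w : List E) → y ++ (y' ++ s ++ w') ++ w ≡ (y ++ y') ++ s ++ w' ++ w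
      regroup-5 y y' s w' w = solve (++-monoid E)

  record Pumpable (c : Config A) (es : List E) (c' : Config A) : Set where
    constructor pumpable
    field
      u p₁ v p₂ x : List E
      splits      : es ≡ u ++ p₁ ++ v ++ p₂ ++ x
      p₁≢[]       : p₁ ≢ []
      p₂≢[]       : p₂ ≢ []
      pumped      : ∀ j → Run c (u ++ rep A j p₁ ++ v ++ rep A j p₂ ++ x) c'

  pumpable-frame : ∀ {T q s T' r c y w c'} L → Pumpable (T , q) s (T' , r) →
    Run c y (T ⁺++ L , q) → Run (T' ⁺++ L , r) w c' → Pumpable c (y ++ s ++ w) c'
  pumpable-frame {c = c} {y} {w} {c'} L (pumpable u p₁ v p₂ x refl p₁≢[] p₂≢[] pumped) into out =
    pumpable (y ++ u) p₁ v p₂ (x ++ w) (regroup y u p₁ v p₂ x w) p₁≢[] p₂≢[] λ j →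
      subst (λ es → Run c es c') (regroup y u (rep A j p₁) v (rep A j p₂) x w)
        (run-++ into (run-++ (run-frame L (pumped j)) out))
    where
      regroup : ∀ (y u a v b x w : List E) →
        y ++ (u ++ a ++ v ++ b ++ x) ++ w ≡ (y ++ u) ++ a ++ v ++ b ++ x ++ w
      regroup y u a v b x w = solve (++-monoid E)

  encloses-pumps : ∀ {k k' s s'} → Encloses k k' s s' → Pumpable (entry k') s' (exit k') →
    Pumpable (entry k) s (exit k)
  encloses-pumps {k' = _ , _ , _} (encloses _ _ P refl _ _ climb leave) pump = pumpable-frame P pump climb leave

  layers : List Γ → ℕ → List Γ → List Γ
  layers P zero    B = B
  layers P (suc j) B = P ++ layers P j B

  layers-++ : ∀ P j B → layers P j (P ++ B) ≡ P ++ layers P j B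
  layers-++ P zero    B = refl
  layers-++ P (suc j) B = cong (P ++_) (layers-++ P j B)

  climb-rep : ∀ {z q P y} → Run (z ∷ [] , q) y (z ∷ P , q) → ∀ j B →
    Run (z ∷ B , q) (rep A j y) (z ∷ layers P j B , q)
  climb-rep r zero    B = done
  climb-rep {z} {q} {P} {y} r (suc j) B =
    run-++ (run-frame B r) (subst (λ X → Run (z ∷ P ++ B , q) (rep A j y) (z ∷ X , q)) (layers-++ P j B)
      (climb-rep r j (P ++ B)))

  descend-rep : ∀ {z r P w} → Run (z ∷ P , r) w (z ∷ [] , r) → ∀ j B →
    Run (z ∷ layers P j B , r) (rep A j w) (z ∷ B , r)
  descend-rep r zero    B = done
  descend-rep r (suc j) B = run-++ (run-frame (layers _ j B) r) (descend-rep r j B)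

  -- A hump enclosing another hump with the same key is pumpable: climb
  -- and descent are repeated j times each around the inner hump.
  self-enclosure-pumps : ∀ {k s s'} → Encloses k k s s' → Run (entry k) s' (exit k) → Pumpable (entry k) s (exit k)
  self-enclosure-pumps {_ , _ , _} {s' = s'} (encloses y w P refl y≢[] w≢[] climb leave) inner =
    pumpable [] y s' w [] (cong (λ t → y ++ s' ++ t) (sym (++-identityʳ w))) y≢[] w≢[] λ j →
      run-++ (climb-rep climb j [])
        (run-++ (run-frame (layers P j []) inner) (run-++ (descend-rep leave j []) done))

  -- A tower of height n: n+1 humps, each strictly inside the previous,
  -- all pushing symbols other than ⊥.
  data Tower : ℕ → Key → List E → Set where
    base : ∀ {k s} → proj₁ k ≢ bot → Run (entry k) s (exit k) → Tower zero k s
    up   : ∀ {n k k' s s'} → proj₁ k ≢ bot → Encloses k k' s s' → Tower n k' s' → Tower (suc n) k s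

  -- The key of the a-th hump of a tower, counted from the outside.
  level : ∀ {n k s} → Tower n k s → Fin (suc n) → Key
  level {k = k} _ zero    = k
  level (up _ _ t) (suc a) = level t a

  level-pushes : ∀ {n k s} (t : Tower n k s) a → proj₁ (level t a) ≢ bot
  level-pushes (base k≢⊥ _) zero   = k≢⊥
  level-pushes (up k≢⊥ _ _) zero   = k≢⊥
  level-pushes (up _ _ t) (suc a)  = level-pushes t a

  tower-run : ∀ {n k s} → Tower n k s → Run (entry k) s (exit k)
  tower-run (base _ r)   = r
  tower-run (up _ e t)   = encloses-run e (tower-run t)

  tower-encloses : ∀ {n k s} (t : Tower (suc n) k s) b →
    ∃[ s' ] Encloses k (level t (suc b)) s s' × Run (entry (level t (suc b))) s' (exit (level t (suc b)))
  tower-encloses (up _ e t) zero = _ , e , tower-run t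
  tower-encloses {suc n} (up _ e t) (suc b) with s' , e' , r ← tower-encloses t b = s' , encloses-trans e e' , r

  tower-pumps : ∀ {n k s} (t : Tower n k s) a b → a <ᶠ b → level t a ≡ level t b → Pumpable (entry k) s (exit k)
  tower-pumps {suc n} {k} {s} t zero (suc b) _ same
    with s' , e , r ← tower-encloses t b
    with e′ , r′ ← subst (λ k' → Encloses k k' s s' × Run (entry k') s' (exit k')) (sym same) (e , r)
    = self-enclosure-pumps e′ r′
  tower-pumps (up _ e t) (suc a) (suc b) a<b same = encloses-pumps e (tower-pumps t a b (s≤s⁻¹ a<b) same)

  -- A hump reaching height n+1 contains a tower of height n: repeat the
  -- excursion argument inside it above height 1.
  tower : ∀ n {k s} → proj₁ k ≢ bot → HighRun (suc n) (entry k) s (exit k) → Tower n k s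
  tower zero    k≢⊥ hr = base k≢⊥ (highrun-run hr)
  tower (suc n) {_ , _ , _} k≢⊥ hr
    with excursion y s' w _ L _ _ refl floor z≢⊥ climb hump leave ← excursion-of {M = 1} hr ≤-refl ≤-refl
    = up k≢⊥ (encloses y w L refl (run-moves climb one≢two) (run-moves leave (one≢two ∘ sym)) climb leave)
         (tower n z≢⊥ hump)
    where
      one≢two : 1 ≢ suc (length L)
      one≢two eq = 0≢1+n (trans (suc-injective eq) floor)

  tall-tower-pumps : ∀ {n k s} → #keys < suc n → Tower n k s → Pumpable (entry k) s (exit k)
  tall-tower-pumps keys< t
    with i , j , i<j , same ← key-collision bot (level t) (level-pushes t) keys<
    = tower-pumps t i j i<j same

  excursion-pumps : ∀ {M n c es c'} → #keys < suc n → Excursion M n c es c' → Pumpable c es c'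
  excursion-pumps {n = n} keys< (excursion u s x z L q r refl _ z≢⊥ climb hump leave) =
    pumpable-frame L (tall-tower-pumps keys< (tower n {z , q , r} z≢⊥ hump)) climb leave

  path-excursion : ∀ {c es cs h} → configs A c es ≡ just cs → suc h ≤ ASH A cs →
    Excursion (height c ⊔ height (last cs)) h c es (last cs)
  path-excursion {c} {es} {cs} {h} cfg gap =
    excursion-of (highrun-lower (gap-below M (SH A cs) h gap′) (configs-peak c es cfg))
      (m≤m⊔n (height c) (height (last cs))) (m≤n⊔m (height c) (height (last cs)))
    where
      M : ℕ
      M = height c ⊔ height (last cs)
      gap′ : suc h ≤ SH A cs ∸ M
      gap′ = subst (λ c₀ → suc h ≤ SH A cs ∸ (height c₀ ⊔ height (last cs))) (configs-head c es cfg) gap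

  pumpable-pair : ∀ {c es c'} → Pumpable c es c' → PumpablePair A c es
  pumpable-pair (pumpable u p₁ v p₂ x splits p₁≢[] p₂≢[] pumped) =
    u , p₁ , v , p₂ , x , splits , p₁≢[] , p₂≢[] , λ j → run-valid (pumped j)

lemma1 : (A : WPS) (c : Config A) (es : List (Fin (WPS.nE A))) (cs : List⁺ (Config A)) →
    configs A c es ≡ just cs →
    ASH A cs ≥ (WPS.nQ A * WPS.nΓ A) ^ 2 →
    PumpablePair A c es
lemma1 A c es cs cfg gap =
  pumpable-pair (excursion-pumps keys< (path-excursion cfg (subst (_≤ ASH A cs) (sym K≡) gap)))
  where
    open WPS A
    open Pumping A
    K : ℕ
    K = (nQ * nΓ) ^ 2
    keys<K : #keys < K
    keys<K = keys<bound nQ nΓ {{nonZeroIndex q₀}} {{nonZeroIndex bot}}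
    K≡ : suc (pred K) ≡ K
    K≡ = suc-pred K {{>-nonZero (≤-<-trans z≤n keys<K)}}
    keys< : #keys < suc (pred K)
    keys< = subst (#keys <_) (sym K≡) keys<K
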